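{- Let $C_1,C_2$ be two $k$-SAT clauses on the same set of $k$ variables that differ in the sign of at least two variables. Then the $2$-blowup of $\{C_1,C_2\}$ contains a simple non-minimal subformula.
   Context: A clause is a conjunction of $k$ literals ($x$ or $\overline x$) on $k$ distinct variables; a formula is a set of clauses; a subformula is a subset of clauses. A formula is simple if no two of its clauses use the same set of $k$ variables. A formula $G$ is minimal if each clause $C\in G$ has a truth assignment satisfying $C$ and no other clause of $G$. The $2$-blowup $G[2]$ replaces each variable $x$ by duplicates $x,x'$ and each clause by all clauses obtained by choosing, for each of its variables, one of its two duplicates (keeping signs). -}

module Defs where

open import Data.Nat using (ℕ)
open import Data.Bool using (Bool; true; false; not)
open import Data.Product using (_×_; _,_; proj₁; proj₂; Σ; ∃; ∃-syntax)
open import Data.List using (List; []; _∷_; map; length; concatMap)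
open import Data.List.Membership.Propositional using (_∈_)
open import Data.List.Relation.Unary.All using (All)
open import Data.List.Relation.Unary.Unique.Propositional using (Unique)
open import Relation.Binary.PropositionalEquality using (_≡_; _≢_)
open import Relation.Nullary using (¬_)
open import Function.Bundles using (_⇔_)

-- A literal over variables V: a variable with a sign (true = x, false = x̄).
Lit : Set → Set
Lit V = V × Bool

-- A clause is a conjunction of literals, represented as a list.
Clause : Set → Set
Clause V = List (Lit V)

vars : {V : Set} → Clause V → List V
vars = map proj₁

IsClause : {V : Set} → ℕ → Clause V → Set
IsClause k C = (length C ≡ k) × Unique (vars C)

Formula : Set → Set
Formula V = List (Clause V)

_⊆F_ : {V : Set} → Formula V → Formula V → Set
H ⊆F G = ∀ {C} → C ∈ H → C ∈ G

Sat : {V : Set} → (V → Bool) → Clause V → Set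
Sat α C = All (λ l → α (proj₁ l) ≡ proj₂ l) C

SameVars : {V : Set} → Clause V → Clause V → Set
SameVars {V} C D = ∀ (x : V) → (x ∈ vars C) ⇔ (x ∈ vars D)

Simple : {V : Set} → Formula V → Set
Simple G = ∀ {C D} → C ∈ G → D ∈ G → SameVars C D → C ≡ D

Minimal : {V : Set} → Formula V → Set
Minimal {V} G = ∀ {C} → C ∈ G →
  ∃[ α ] (Sat α C × (∀ {D} → D ∈ G → D ≢ C → ¬ Sat α D))

-- 2-blowup: variable x becomes duplicates (x , false) and (x , true).
blowupClause : {V : Set} → Clause V → Formula (V × Bool)
blowupClause [] = [] ∷ []
blowupClause ((x , s) ∷ C) =
  concatMap (λ b → map (λ R → ((x , b) , s) ∷ R) (blowupClause C)) (false ∷ true ∷ [])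

blowup : {V : Set} → Formula V → Formula (V × Bool)
blowup = concatMap blowupClause

DiffSign : {V : Set} → Clause V → Clause V → V → Set
DiffSign C₁ C₂ x = ∃[ s ] (((x , s) ∈ C₁) × ((x , not s) ∈ C₂))

-- Write the copy of variable x chosen for a literal of sign s as (x , s); the
-- diagonal clause E₁ of C₁ puts every literal on the copy indexed by its own
-- sign.  Take H = E₁, E₂ and the clauses obtained from E₁ by moving a single
-- literal to its other copy.  An assignment satisfying E₁ either satisfies one
-- of these one-flip neighbours, or gives every copy (x , b) the value b, and
-- then it also satisfies E₂ ≠ E₁; so no assignment isolates E₁ in H.
-- H is simple: E₁ and E₂ use different copies of x, and each neighbour uses a
-- single copy outside E₁, whereas E₂ uses two (those of x and y).
module Submission where

open import Defs
open import Data.Nat using (ℕ)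
open import Data.Bool using (Bool; true; false; not; _≟_)
open import Data.Bool.Properties using (not-¬; ¬-not)
open import Data.Product using (_×_; _,_; ∃-syntax; ∃₂; proj₁; proj₂)
open import Data.Sum using (_⊎_; inj₁; inj₂)
open import Data.Empty using (⊥-elim)
open import Data.List using (List; []; _∷_; map)
open import Data.List.Properties using (map-∘; map-id; ∷-injectiveˡ; ∷-injectiveʳ)
open import Data.List.Relation.Unary.Any using (here; there)
open import Data.List.Relation.Unary.All as All using (All; []; _∷_; lookup)
import Data.List.Relation.Unary.All.Properties as Allₚ
open import Data.List.Relation.Unary.AllPairs using (_∷_)
open import Data.List.Relation.Unary.Unique.Propositional using (Unique)
open import Data.List.Membership.Propositional using (_∈_; _∉_)
open import Data.List.Membership.Propositional.Properties using (∈-map⁺; ∈-map⁻; ∈-++⁺ˡ; ∈-++⁺ʳ)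
open import Data.List.Relation.Binary.Subset.Propositional using (_⊆_)
open import Data.List.Relation.Binary.Subset.Propositional.Properties
  using (⊆-trans; xs⊆x∷xs; ⊆∷∧∉⇒⊆; All-resp-⊇)
open import Function using (_∘_)
open import Function.Bundles using (Equivalence; mk⇔)
import Function.Properties.Equivalence as ⇔
open import Relation.Binary.PropositionalEquality using (_≡_; _≢_; refl; sym; trans; cong; subst)
open import Relation.Nullary using (¬_; yes; no)

open Equivalence using (to; from)

map-unique⇒injective : {A B : Set} (f : A → B) {xs : List A} → Unique (map f xs) →
  ∀ {a b} → a ∈ xs → b ∈ xs → f a ≡ f b → a ≡ b
map-unique⇒injective f {_ ∷ _} _          (here refl) (here refl) _   = refl
map-unique⇒injective f {_ ∷ _} (fx∉ ∷ _) (here refl) (there q)   fab = ⊥-elim (lookup fx∉ (∈-map⁺ f q) fab)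
map-unique⇒injective f {_ ∷ _} (fx∉ ∷ _) (there p)   (here refl) fab = ⊥-elim (lookup fx∉ (∈-map⁺ f p) (sym fab))
map-unique⇒injective f {_ ∷ _} (_ ∷ u)   (there p)   (there q)   fab = map-unique⇒injective f u p q fab

module _ {V : Set} where

  sign-unique : {C : Clause V} → Unique (vars C) → ∀ {v a b} → (v , a) ∈ C → (v , b) ∈ C → a ≡ b
  sign-unique u p q = cong proj₂ (map-unique⇒injective proj₁ u p q refl)

  opposite-signs-excluded : {C : Clause V} → Unique (vars C) → ∀ {v s} → (v , s) ∈ C → (v , not s) ∉ C
  opposite-signs-excluded u p q = not-¬ refl (sign-unique u p q)

  sameVars-sym : {C D : Clause V} → SameVars C D → SameVars D C
  sameVars-sym same x = ⇔.sym (same x)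

  simple-∷ : {C : Clause V} {G : Formula V} →
    (∀ {D} → D ∈ G → ¬ SameVars C D) → Simple G → Simple (C ∷ G)
  simple-∷ C≁G simpleG (here refl) (here refl) _    = refl
  simple-∷ C≁G simpleG (here refl) (there q)   same = ⊥-elim (C≁G q same)
  simple-∷ C≁G simpleG (there p)   (here refl) same = ⊥-elim (C≁G p (sameVars-sym same))
  simple-∷ C≁G simpleG (there p)   (there q)   same = simpleG p q same

  simple-map-∷ : (l : Lit V) {G : Formula V} →
    (∀ {D} → D ∈ G → proj₁ l ∉ vars D) → Simple G → Simple (map (l ∷_) G)
  simple-map-∷ l fresh simpleG p q same with ∈-map⁻ (l ∷_) p | ∈-map⁻ (l ∷_) q
  ... | D₁ , p′ , refl | D₂ , q′ , refl =
    cong (l ∷_) (simpleG p′ q′ λ x → mk⇔ (D₁⊆D₂ {x}) (D₂⊆D₁ {x}))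
    where
    dropHead : ∀ {xs ys} → proj₁ l ∉ xs → proj₁ l ∷ xs ⊆ proj₁ l ∷ ys → xs ⊆ ys
    dropHead l∉xs sub = ⊆∷∧∉⇒⊆ (⊆-trans (xs⊆x∷xs _ _) sub) l∉xs

    D₁⊆D₂ : vars D₁ ⊆ vars D₂
    D₁⊆D₂ = dropHead (fresh p′) (λ {w} → to (same w))
    D₂⊆D₁ : vars D₂ ⊆ vars D₁
    D₂⊆D₁ = dropHead (fresh q′) (λ {w} → from (same w))

module _ {V : Set} where

  ownCopy : Lit V → Lit (V × Bool)
  ownCopy (v , s) = ((v , s) , s)

  otherCopy : Lit V → Lit (V × Bool)
  otherCopy (v , s) = ((v , not s) , s)

  diagonal : Clause V → Clause (V × Bool)
  diagonal = map ownCopy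

  oneFlips : Clause V → Formula (V × Bool)
  oneFlips []      = []
  oneFlips (l ∷ C) = (otherCopy l ∷ diagonal C) ∷ map (ownCopy l ∷_) (oneFlips C)

  neighbourhood : Clause V → Clause V → Formula (V × Bool)
  neighbourhood C₁ C₂ = diagonal C₁ ∷ diagonal C₂ ∷ oneFlips C₁

  data Choice : Clause (V × Bool) → Clause V → Set where
    []  : Choice [] []
    _∷_ : ∀ {D C v s} b → Choice D C → Choice (((v , b) , s) ∷ D) ((v , s) ∷ C)

  Choice⇒∈blowupClause : ∀ {D C} → Choice D C → D ∈ blowupClause C
  Choice⇒∈blowupClause [] = here refl
  Choice⇒∈blowupClause {C = (v , s) ∷ C} (false ∷ ch) =
    ∈-++⁺ˡ (∈-map⁺ (((v , false) , s) ∷_) (Choice⇒∈blowupClause ch))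
  Choice⇒∈blowupClause {C = (v , s) ∷ C} (true ∷ ch) =
    ∈-++⁺ʳ (map (((v , false) , s) ∷_) (blowupClause C))
      (∈-++⁺ˡ (∈-map⁺ (((v , true) , s) ∷_) (Choice⇒∈blowupClause ch)))

  diagonal-Choice : ∀ C → Choice (diagonal C) C
  diagonal-Choice []            = []
  diagonal-Choice ((v , s) ∷ C) = s ∷ diagonal-Choice C

  oneFlips-Choice : ∀ C {D} → D ∈ oneFlips C → Choice D C
  oneFlips-Choice ((v , s) ∷ C) (here refl) = not s ∷ diagonal-Choice C
  oneFlips-Choice ((v , s) ∷ C) (there p) with ∈-map⁻ (ownCopy (v , s) ∷_) p
  ... | D , q , refl = s ∷ oneFlips-Choice C q

  neighbourhood⊆blowup : ∀ C₁ C₂ → neighbourhood C₁ C₂ ⊆F blowup (C₁ ∷ C₂ ∷ [])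
  neighbourhood⊆blowup C₁ C₂ (here refl) = ∈-++⁺ˡ (Choice⇒∈blowupClause (diagonal-Choice C₁))
  neighbourhood⊆blowup C₁ C₂ (there (here refl)) =
    ∈-++⁺ʳ (blowupClause C₁) (∈-++⁺ˡ (Choice⇒∈blowupClause (diagonal-Choice C₂)))
  neighbourhood⊆blowup C₁ C₂ (there (there p)) = ∈-++⁺ˡ (Choice⇒∈blowupClause (oneFlips-Choice C₁ p))

  vars-diagonal : ∀ C → vars (diagonal C) ≡ C
  vars-diagonal C = trans (sym (map-∘ C)) (map-id C)

  ∈-vars-diagonal⁺ : ∀ C {w} → w ∈ C → w ∈ vars (diagonal C)
  ∈-vars-diagonal⁺ C {w} = subst (w ∈_) (sym (vars-diagonal C))

  ∈-vars-diagonal⁻ : ∀ C {w} → w ∈ vars (diagonal C) → w ∈ C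
  ∈-vars-diagonal⁻ C {w} = subst (w ∈_) (vars-diagonal C)

  vars-oneFlip : ∀ C {D} → D ∈ oneFlips C →
    ∃₂ λ u t → (u , t) ∈ C × (u , not t) ∈ vars D × vars D ⊆ (u , not t) ∷ C
  vars-oneFlip ((v , s) ∷ C) (here refl) = v , s , here refl , here refl , flipped⊆
    where
    flipped⊆ : vars (otherCopy (v , s) ∷ diagonal C) ⊆ (v , not s) ∷ (v , s) ∷ C
    flipped⊆ (here e)  = here e
    flipped⊆ (there q) = there (there (∈-vars-diagonal⁻ C q))
  vars-oneFlip ((v , s) ∷ C) (there p) with ∈-map⁻ (ownCopy (v , s) ∷_) p
  ... | D , q , refl with vars-oneFlip C q
  ... | u , t , ut∈C , flip∈D , D⊆ = u , t , there ut∈C , there flip∈D , extended⊆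
    where
    extended⊆ : vars (ownCopy (v , s) ∷ D) ⊆ (u , not t) ∷ (v , s) ∷ C
    extended⊆ (here e) = there (here e)
    extended⊆ (there r) with D⊆ r
    ... | here e  = here e
    ... | there w∈C = there (there w∈C)

  variable-oneFlip : ∀ C {D w} → D ∈ oneFlips C → w ∈ vars D → proj₁ w ∈ vars C
  variable-oneFlip C p w∈D with vars-oneFlip C p
  ... | u , t , ut∈C , _ , D⊆ with D⊆ w∈D
  ... | here refl = ∈-map⁺ proj₁ ut∈C
  ... | there w∈C = ∈-map⁺ proj₁ w∈C

  oneFlips-simple : ∀ C → Unique (vars C) → Simple (oneFlips C)
  oneFlips-simple [] _ ()
  oneFlips-simple ((v , s) ∷ C) (v∉C ∷ u) =
    simple-∷ head≁tail (simple-map-∷ (ownCopy (v , s)) fresh (oneFlips-simple C u))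
    where
    fresh : ∀ {D} → D ∈ oneFlips C → (v , s) ∉ vars D
    fresh p w∈D = lookup v∉C (variable-oneFlip C p w∈D) refl

    head≁tail : ∀ {D} → D ∈ map (ownCopy (v , s) ∷_) (oneFlips C) →
      ¬ SameVars (otherCopy (v , s) ∷ diagonal C) D
    head≁tail p same with ∈-map⁻ (ownCopy (v , s) ∷_) p
    ... | D , _ , refl with from (same (v , s)) (here refl)
    ... | here e  = not-¬ refl (cong proj₂ e)
    ... | there q = lookup v∉C (∈-map⁺ proj₁ (∈-vars-diagonal⁻ C q)) refl

  diagonal-≁-oneFlip : ∀ {C D} → Unique (vars C) → D ∈ oneFlips C → ¬ SameVars (diagonal C) D
  diagonal-≁-oneFlip {C} u p same with vars-oneFlip C p
  ... | u′ , t , ut∈C , flip∈D , _ =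
    opposite-signs-excluded u ut∈C (∈-vars-diagonal⁻ C (from (same (u′ , not t)) flip∈D))

  diagonals-≁ : ∀ {C₁ C₂ x s} → Unique (vars C₂) → (x , s) ∈ C₁ → (x , not s) ∈ C₂ →
    ¬ SameVars (diagonal C₁) (diagonal C₂)
  diagonals-≁ {C₁} {C₂} u₂ x₁ x₂ same =
    opposite-signs-excluded u₂ (∈-vars-diagonal⁻ C₂ (to (same _) (∈-vars-diagonal⁺ C₁ x₁))) x₂

  twoSignChanges⇒diagonal-≁-oneFlip : ∀ {C₁ C₂ D} → Unique (vars C₁) → D ∈ oneFlips C₁ →
    ∀ {x y} → x ≢ y → DiffSign C₁ C₂ x → DiffSign C₁ C₂ y → ¬ SameVars (diagonal C₂) D
  twoSignChanges⇒diagonal-≁-oneFlip {C₁} {C₂} u₁ p x≢y (s , x₁ , x₂) (s′ , y₁ , y₂) same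
    with vars-oneFlip C₁ p
  ... | u , t , _ , _ , D⊆ = x≢y (trans (flipped x₁ x₂) (sym (flipped y₁ y₂)))
    where
    flipped : ∀ {v b} → (v , b) ∈ C₁ → (v , not b) ∈ C₂ → v ≡ u
    flipped vb∈C₁ vb∈C₂ with D⊆ (to (same _) (∈-vars-diagonal⁺ C₂ vb∈C₂))
    ... | here e       = cong proj₁ e
    ... | there vb∈C₁′ = ⊥-elim (opposite-signs-excluded u₁ vb∈C₁ vb∈C₁′)

  neighbourhood-simple : ∀ {C₁ C₂ x y} → Unique (vars C₁) → Unique (vars C₂) →
    x ≢ y → DiffSign C₁ C₂ x → DiffSign C₁ C₂ y → Simple (neighbourhood C₁ C₂)
  neighbourhood-simple {C₁} {C₂} u₁ u₂ x≢y dx@(_ , x₁ , x₂) dy =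
    simple-∷ E₁≁ (simple-∷ E₂≁ (oneFlips-simple C₁ u₁))
    where
    E₁≁ : ∀ {D} → D ∈ diagonal C₂ ∷ oneFlips C₁ → ¬ SameVars (diagonal C₁) D
    E₁≁ (here refl) = diagonals-≁ u₂ x₁ x₂
    E₁≁ (there p)   = diagonal-≁-oneFlip u₁ p

    E₂≁ : ∀ {D} → D ∈ oneFlips C₁ → ¬ SameVars (diagonal C₂) D
    E₂≁ p = twoSignChanges⇒diagonal-≁-oneFlip u₁ p x≢y dx dy

  Diagonal : (V × Bool → Bool) → V → Set
  Diagonal α v = ∀ b → α (v , b) ≡ b

  diagonal-both-signs : ∀ α v s → α (v , s) ≡ s → α (v , not s) ≡ not s → Diagonal α v
  diagonal-both-signs α v true  own other true  = own
  diagonal-both-signs α v true  own other false = other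
  diagonal-both-signs α v false own other true  = other
  diagonal-both-signs α v false own other false = own

  Diagonal⇒sat-diagonal : ∀ α C → All (Diagonal α) (vars C) → Sat α (diagonal C)
  Diagonal⇒sat-diagonal α C diag = Allₚ.map⁺ (All.map (λ {l} d → d (proj₂ l)) (Allₚ.map⁻ diag))

  sat-diagonal⇒oneFlip⊎Diagonal : ∀ α C → Sat α (diagonal C) →
    (∃[ D ] D ∈ oneFlips C × Sat α D) ⊎ All (Diagonal α) (vars C)
  sat-diagonal⇒oneFlip⊎Diagonal α [] [] = inj₂ []
  sat-diagonal⇒oneFlip⊎Diagonal α ((v , s) ∷ C) (own ∷ rest) with α (v , not s) ≟ s
  ... | yes other = inj₁ (_ , here refl , other ∷ rest)
  ... | no other with sat-diagonal⇒oneFlip⊎Diagonal α C rest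
  ... | inj₁ (D , p , sat) = inj₁ (_ , there (∈-map⁺ (ownCopy (v , s) ∷_) p) , own ∷ sat)
  ... | inj₂ diag          = inj₂ (diagonal-both-signs α v s own (¬-not other) ∷ diag)

  oneFlip≢diagonal : ∀ C {D} → D ∈ oneFlips C → D ≢ diagonal C
  oneFlip≢diagonal ((v , s) ∷ C) (here refl) e = not-¬ refl (sym (cong (proj₂ ∘ proj₁) (∷-injectiveˡ e)))
  oneFlip≢diagonal ((v , s) ∷ C) (there p) e with ∈-map⁻ (ownCopy (v , s) ∷_) p
  ... | D , q , refl = oneFlip≢diagonal C q (∷-injectiveʳ e)

  diagonal-injective : ∀ {C₁ C₂} → diagonal C₁ ≡ diagonal C₂ → C₁ ≡ C₂
  diagonal-injective {C₁} {C₂} e = trans (sym (vars-diagonal C₁)) (trans (cong vars e) (vars-diagonal C₂))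

  neighbourhood-¬minimal : ∀ {C₁ C₂} → vars C₂ ⊆ vars C₁ → C₁ ≢ C₂ → ¬ Minimal (neighbourhood C₁ C₂)
  neighbourhood-¬minimal {C₁} {C₂} C₂⊆C₁ C₁≢C₂ minimal with minimal (here refl)
  ... | α , satE₁ , isolated with sat-diagonal⇒oneFlip⊎Diagonal α C₁ satE₁
  ... | inj₁ (D , p , satD) = isolated (there (there p)) (oneFlip≢diagonal C₁ p) satD
  ... | inj₂ diag =
    isolated (there (here refl)) (C₁≢C₂ ∘ sym ∘ diagonal-injective)
      (Diagonal⇒sat-diagonal α C₂ (All-resp-⊇ C₂⊆C₁ diag))

lemma4p2 : {V : Set} (k : ℕ) (C₁ C₂ : Clause V) →
    IsClause k C₁ → IsClause k C₂ → SameVars C₁ C₂ →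
    (∃[ x ] ∃[ y ] (x ≢ y × DiffSign C₁ C₂ x × DiffSign C₁ C₂ y)) →
    ∃[ H ] (H ⊆F blowup (C₁ ∷ C₂ ∷ []) × Simple H × ¬ Minimal H)
lemma4p2 k C₁ C₂ (_ , u₁) (_ , u₂) same (x , y , x≢y , dx@(_ , x₁ , x₂) , dy) =
  neighbourhood C₁ C₂ ,
  neighbourhood⊆blowup C₁ C₂ ,
  neighbourhood-simple u₁ u₂ x≢y dx dy ,
  neighbourhood-¬minimal (λ {v} → from (same v)) C₁≢C₂
  where
  C₁≢C₂ : C₁ ≢ C₂
  C₁≢C₂ refl = opposite-signs-excluded u₂ x₁ x₂
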